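{- For each even integer $t \ge 4$ define \begin{align*} U_t(x) &= 2x^{2t-1} + x^{t+3} - x^{t+2} + x^{t+1} - 3x^t + 3x^{t-1} - x^{t-2} + x^{t-3} - x^{t-4} - 2,\\ W_t(x) &= 2x^{2t-1} - x^{t+3} + x^{t+2} - x^{t+1} - x^t + x^{t-1} + x^{t-2} - x^{t-3} + x^{t-4} - 2. \end{align*} For any even $t \ge 4$ and each integer $\beta \ge 6$, neither $U_t(x)$ nor $W_t(x)$ is divisible by a polynomial $V(x) \in \mathbb{Q}[x]$ having at least two non-zero terms and all of whose terms have exponents divisible by $\beta$. -}

module Defs where

open import Data.Nat using (ℕ; zero; suc; _∸_) renaming (_+_ to _+ℕ_; _*_ to _*ℕ_)
open import Data.Integer using (ℤ; +_; -[1+_])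
open import Data.Rational using (ℚ; 0ℚ; _/_) renaming (_+_ to _+ℚ_; _*_ to _*ℚ_)
open import Data.List using (List; []; _∷_; _++_; replicate; map; foldr)
open import Data.Product using (_×_; _,_; ∃)
open import Relation.Binary.PropositionalEquality using (_≡_)

-- Polynomials in ℚ[x], as coefficient lists: the i-th entry is the
-- coefficient of x^i (trailing zeros allowed).
Poly : Set
Poly = List ℚ

coeff : Poly → ℕ → ℚ
coeff []       _       = 0ℚ
coeff (a ∷ _)  zero    = a
coeff (_ ∷ p)  (suc n) = coeff p n

infixl 6 _+P_
infixl 7 _*P_

_+P_ : Poly → Poly → Poly
[]      +P q       = q
(a ∷ p) +P []      = a ∷ p
(a ∷ p) +P (b ∷ q) = (a +ℚ b) ∷ (p +P q)

scaleP : ℚ → Poly → Poly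
scaleP c p = map (c *ℚ_) p

_*P_ : Poly → Poly → Poly
[]      *P q = []
(a ∷ p) *P q = scaleP a q +P (0ℚ ∷ (p *P q))

monomial : ℚ → ℕ → Poly
monomial c e = replicate e 0ℚ ++ (c ∷ [])

int : ℤ → ℚ
int z = z / 1

fromTerms : List (ℤ × ℕ) → Poly
fromTerms = foldr (λ { (c , e) p → monomial (int c) e +P p }) []

_≈P_ : Poly → Poly → Set
p ≈P q = ∀ n → coeff p n ≡ coeff q n

_∣P_ : Poly → Poly → Set
V ∣P P = ∃ λ (Q : Poly) → (V *P Q) ≈P P

U : ℕ → Poly
U t = fromTerms
  ( (+ 2 , (2 *ℕ t) ∸ 1)
  ∷ (+ 1 , t +ℕ 3)
  ∷ (-[1+ 0 ] , t +ℕ 2)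
  ∷ (+ 1 , t +ℕ 1)
  ∷ (-[1+ 2 ] , t)
  ∷ (+ 3 , t ∸ 1)
  ∷ (-[1+ 0 ] , t ∸ 2)
  ∷ (+ 1 , t ∸ 3)
  ∷ (-[1+ 0 ] , t ∸ 4)
  ∷ (-[1+ 1 ] , 0)
  ∷ [])

W : ℕ → Poly
W t = fromTerms
  ( (+ 2 , (2 *ℕ t) ∸ 1)
  ∷ (-[1+ 0 ] , t +ℕ 3)
  ∷ (+ 1 , t +ℕ 2)
  ∷ (-[1+ 0 ] , t +ℕ 1)
  ∷ (-[1+ 0 ] , t)
  ∷ (+ 1 , t ∸ 1)
  ∷ (+ 1 , t ∸ 2)
  ∷ (-[1+ 0 ] , t ∸ 3)
  ∷ (+ 1 , t ∸ 4)
  ∷ (-[1+ 1 ] , 0)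
  ∷ [])

-- Suppose V divides P, where V has at least two terms and all its exponents are multiples
-- of β, and P has a term c x^e that is the only term of P whose exponent is ≡ e mod β.
-- Write P = V Q and let Q' be the part of Q with exponents ≡ e mod β; since V only
-- shifts exponents by multiples of β, the part of P in that class is c x^e = V Q'.
-- But the lowest and the highest terms of V times those of Q' give two different terms
-- of V Q'.  For U_t and W_t one of the exponents t - 2, t - 1, t is such an isolated
-- exponent: t - 4, …, t + 3 lie within distance 5 < β of each of them, and the two
-- remaining exponents 2t - 1 and 0 occupy at most two residue classes.
module Submission where

open import Defs
open import Data.Nat
  using (ℕ; zero; suc; pred; _+_; _*_; _∸_; _≤_; _<_; _≤?_; z≤n; s≤s; z<s; s<s; NonZero; anyUpTo?)
open import Data.Nat.Properties
  using (_≟_; ≤-trans; ≤-antisym; ≤-pred; <-irrefl; <⇒≢; ≤∧≢⇒<; ≮⇒≥; n≮0; +-comm; +-mono-<-≤)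
open import Data.Nat.Properties using (m+n∸n≡m; [m+n]∸[m+o]≡n∸o; *-distribʳ-∸)
open import Data.Nat.DivMod using (_%_; _/_; m≡m%n+[m/n]*n; %-remove-+ˡ)
open import Data.Nat.Divisibility using (_∣_; divides; >⇒∤)
open import Data.Nat.Induction using (<-rec)
open import Data.Integer using (ℤ; +_; -[1+_])
open import Data.Rational using (ℚ; 0ℚ; 1ℚ; 1/_; ≢-nonZero) renaming (_+_ to _+ℚ_; _*_ to _*ℚ_)
import Data.Rational.Properties as ℚP
open ℚP using () renaming (_≟_ to _≟ℚ_)
open import Data.List using (List; []; _∷_; _++_; length; take; drop)
open import Data.List.Relation.Unary.All using (All; []; _∷_)
open import Data.List.Relation.Unary.All.Properties using (++⁺)
import Data.List.Relation.Unary.All as All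
open import Data.Product using (_×_; _,_; ∃; ∃₂; proj₁; proj₂)
open import Data.Sum using (_⊎_; inj₁; inj₂)
open import Data.Empty using (⊥-elim)
open import Function using (_∘_)
open import Relation.Nullary using (¬_; yes; no)
open import Relation.Nullary.Decidable using (True; toWitness; decidable-stable; ¬?; _×-dec_)
open import Relation.Unary using (Pred; Decidable)
open import Relation.Binary.PropositionalEquality

*-≢0 : ∀ {p q} → p ≢ 0ℚ → q ≢ 0ℚ → p *ℚ q ≢ 0ℚ
*-≢0 {p} {q} p≢0 q≢0 pq≡0 = q≢0 (begin
    q                 ≡⟨ ℚP.*-identityˡ q ⟨
    1ℚ *ℚ q           ≡⟨ cong (_*ℚ q) (ℚP.*-inverseˡ p) ⟨
    (1/ p *ℚ p) *ℚ q  ≡⟨ ℚP.*-assoc (1/ p) p q ⟩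
    1/ p *ℚ (p *ℚ q)  ≡⟨ cong (1/ p *ℚ_) pq≡0 ⟩
    1/ p *ℚ 0ℚ        ≡⟨ ℚP.*-zeroʳ (1/ p) ⟩
    0ℚ                ∎)
  where
  open ≡-Reasoning
  instance _ = ≢-nonZero p≢0

*≢0⇒ˡ≢0 : ∀ p q → p *ℚ q ≢ 0ℚ → p ≢ 0ℚ
*≢0⇒ˡ≢0 p q pq≢0 refl = pq≢0 (ℚP.*-zeroˡ q)

*≢0⇒ʳ≢0 : ∀ p q → p *ℚ q ≢ 0ℚ → q ≢ 0ℚ
*≢0⇒ʳ≢0 p q pq≢0 refl = pq≢0 (ℚP.*-zeroʳ p)

≤-+-≡⇒≡ : ∀ {m n o p} → m ≤ n → o ≤ p → m + o ≡ n + p → m ≡ n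
≤-+-≡⇒≡ m≤n o≤p m+o≡n+p =
  ≤-antisym m≤n (≮⇒≥ λ m<n → <⇒≢ (+-mono-<-≤ m<n o≤p) m+o≡n+p)

Least Greatest : ∀ {p} → Pred ℕ p → Pred ℕ p
Least    P m = P m × (∀ {k} → P k → m ≤ k)
Greatest P m = P m × (∀ {k} → P k → k ≤ m)

module _ {p} {P : Pred ℕ p} (P? : Decidable P) where

  least : ∀ {n} → P n → ∃ (Least P)
  least {n} = <-rec (λ n → P n → ∃ (Least P)) minimise n
    where
    minimise : ∀ n → (∀ {k} → k < n → P k → ∃ (Least P)) → P n → ∃ (Least P)
    minimise n below Pn with anyUpTo? P? n
    ... | yes (k , k<n , Pk) = below k<n Pk
    ... | no ∄k<n            = n , Pn , λ Pk → ≮⇒≥ λ k<n → ∄k<n (_ , k<n , Pk)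

  greatest : ∀ N → (∀ {k} → P k → k < N) → ∀ {n} → P n → ∃ (Greatest P)
  greatest zero    bounded Pn = ⊥-elim (n≮0 (bounded Pn))
  greatest (suc N) bounded Pn with P? N
  ... | yes PN = N , PN , ≤-pred ∘ bounded
  ... | no ¬PN = greatest N (λ Pk → ≤∧≢⇒< (≤-pred (bounded Pk)) (λ k≡N → ¬PN (subst P k≡N Pk))) Pn

least<greatest : ∀ {p} {P : Pred ℕ p} {m M a b} → Least P m → Greatest P M → P a → P b → a ≢ b → m < M
least<greatest {P = P} {m} {M} (_ , m≤) (_ , ≤M) Pa Pb a≢b =
  ≤∧≢⇒< (≤-trans (m≤ Pa) (≤M Pa)) λ m≡M → a≢b (trans (pinned m≡M Pa) (sym (pinned m≡M Pb)))
  where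
  pinned : ∀ {k} → m ≡ M → P k → k ≡ m
  pinned m≡M Pk = ≤-antisym (subst (_ ≤_) (sym m≡M) (≤M Pk)) (m≤ Pk)

coeff-+P : ∀ p q n → coeff (p +P q) n ≡ coeff p n +ℚ coeff q n
coeff-+P []      q       n       = sym (ℚP.+-identityˡ _)
coeff-+P (a ∷ p) []      zero    = sym (ℚP.+-identityʳ a)
coeff-+P (a ∷ p) []      (suc n) = sym (ℚP.+-identityʳ _)
coeff-+P (a ∷ p) (b ∷ q) zero    = refl
coeff-+P (a ∷ p) (b ∷ q) (suc n) = coeff-+P p q n

coeff-scaleP : ∀ c q n → coeff (scaleP c q) n ≡ c *ℚ coeff q n
coeff-scaleP c []      n       = sym (ℚP.*-zeroʳ c)
coeff-scaleP c (a ∷ q) zero    = refl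
coeff-scaleP c (a ∷ q) (suc n) = coeff-scaleP c q n

coeff≢0? : ∀ p → Decidable (λ k → coeff p k ≢ 0ℚ)
coeff≢0? p k = ¬? (coeff p k ≟ℚ 0ℚ)

coeff≢0⇒<length : ∀ p {k} → coeff p k ≢ 0ℚ → k < length p
coeff≢0⇒<length []      {k}     pₖ≢0 = ⊥-elim (pₖ≢0 refl)
coeff≢0⇒<length (_ ∷ p) {zero}  _    = z<s
coeff≢0⇒<length (_ ∷ p) {suc k} pₖ≢0 = s<s (coeff≢0⇒<length p pₖ≢0)

convolution : (ℕ → ℚ) → (ℕ → ℚ) → ℕ → ℚ
convolution f g zero    = f 0 *ℚ g 0
convolution f g (suc n) = f 0 *ℚ g (suc n) +ℚ convolution (f ∘ suc) g n

convolution-≢0 : ∀ f g n → convolution f g n ≢ 0ℚ → ∃₂ λ i j → i + j ≡ n × f i *ℚ g j ≢ 0ℚ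
convolution-≢0 f g zero    c≢0 = 0 , 0 , refl , c≢0
convolution-≢0 f g (suc n) c≢0 with f 0 *ℚ g (suc n) ≟ℚ 0ℚ
... | no f₀g≢0 = 0 , suc n , refl , f₀g≢0
... | yes f₀g≡0
  with i , j , i+j≡n , fg≢0 ← convolution-≢0 (f ∘ suc) g n
         (λ c≡0 → c≢0 (trans (cong₂ _+ℚ_ f₀g≡0 c≡0) (ℚP.+-identityˡ 0ℚ)))
  = suc i , j , cong suc i+j≡n , fg≢0

convolution-vanishing : ∀ f g n → (∀ {i j} → i + j ≡ n → f i *ℚ g j ≡ 0ℚ) → convolution f g n ≡ 0ℚ
convolution-vanishing f g n vanish = decidable-stable (_ ≟ℚ 0ℚ) λ c≢0 →
  let i , j , i+j≡n , fg≢0 = convolution-≢0 f g n c≢0 in fg≢0 (vanish i+j≡n)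

convolution-single : ∀ f g i₀ j₀ → (∀ {i j} → i + j ≡ i₀ + j₀ → i ≢ i₀ → f i *ℚ g j ≡ 0ℚ)
  → convolution f g (i₀ + j₀) ≡ f i₀ *ℚ g j₀
convolution-single f g zero    zero    vanish = refl
convolution-single f g zero    (suc n) vanish =
  trans (cong (f 0 *ℚ g (suc n) +ℚ_) (convolution-vanishing (f ∘ suc) g n λ i+j≡n →
           vanish (cong suc i+j≡n) λ ()))
        (ℚP.+-identityʳ _)
convolution-single f g (suc i₀) j₀ vanish =
  trans (cong₂ _+ℚ_ (vanish refl λ ()) (convolution-single (f ∘ suc) g i₀ j₀ λ i+j≡ i≢i₀ →
           vanish (cong suc i+j≡) (i≢i₀ ∘ cong pred)))
        (ℚP.+-identityˡ _)

coeff-*P : ∀ p q n → coeff (p *P q) n ≡ convolution (coeff p) (coeff q) n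
coeff-*P []      q n       = sym (convolution-vanishing (coeff []) (coeff q) n λ {_} {j} _ → ℚP.*-zeroˡ (coeff q j))
coeff-*P (a ∷ p) q zero    =
  trans (coeff-+P (scaleP a q) (0ℚ ∷ p *P q) 0) (trans (ℚP.+-identityʳ _) (coeff-scaleP a q 0))
coeff-*P (a ∷ p) q (suc n) =
  trans (coeff-+P (scaleP a q) (0ℚ ∷ p *P q) (suc n)) (cong₂ _+ℚ_ (coeff-scaleP a q (suc n)) (coeff-*P p q n))

coeff-monomial-≡ : ∀ c e → coeff (monomial c e) e ≡ c
coeff-monomial-≡ c zero    = refl
coeff-monomial-≡ c (suc e) = coeff-monomial-≡ c e

coeff-monomial-≢ : ∀ c {e k} → k ≢ e → coeff (monomial c e) k ≡ 0ℚ
coeff-monomial-≢ c {zero}  {zero}  k≢e = ⊥-elim (k≢e refl)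
coeff-monomial-≢ c {zero}  {suc k} k≢e = refl
coeff-monomial-≢ c {suc e} {zero}  k≢e = refl
coeff-monomial-≢ c {suc e} {suc k} k≢e = coeff-monomial-≢ c (k≢e ∘ cong suc)

ExponentOtherThan : ℕ → ℤ × ℕ → Set
ExponentOtherThan k t = k ≢ proj₂ t

coeff-fromTerms-∉ : ∀ {k} ts → All (ExponentOtherThan k) ts → coeff (fromTerms ts) k ≡ 0ℚ
coeff-fromTerms-∉ []             []          = refl
coeff-fromTerms-∉ ((c , x) ∷ ts) (k≢x ∷ k∉) =
  trans (coeff-+P (monomial (int c) x) (fromTerms ts) _)
        (trans (cong₂ _+ℚ_ (coeff-monomial-≢ (int c) k≢x) (coeff-fromTerms-∉ ts k∉)) (ℚP.+-identityˡ 0ℚ))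

coeff-fromTerms-sole : ∀ {c e} pre post → All (ExponentOtherThan e) pre → All (ExponentOtherThan e) post
  → coeff (fromTerms (pre ++ (c , e) ∷ post)) e ≡ int c
coeff-fromTerms-sole {c} {e} [] post [] e∉post =
  trans (coeff-+P (monomial (int c) e) (fromTerms post) e)
        (trans (cong₂ _+ℚ_ (coeff-monomial-≡ (int c) e) (coeff-fromTerms-∉ post e∉post)) (ℚP.+-identityʳ _))
coeff-fromTerms-sole {c} {e} ((c′ , x) ∷ pre) post (e≢x ∷ e∉pre) e∉post =
  trans (coeff-+P (monomial (int c′) x) (fromTerms (pre ++ (c , e) ∷ post)) e)
        (trans (cong₂ _+ℚ_ (coeff-monomial-≢ (int c′) e≢x) (coeff-fromTerms-sole pre post e∉pre e∉post))
               (ℚP.+-identityˡ _))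

module _ (β : ℕ) .{{_ : NonZero β}} where

  ≡-mod⇒∣∸ : ∀ {m n} → m % β ≡ n % β → β ∣ n ∸ m
  ≡-mod⇒∣∸ {m} {n} m≡n = divides (n / β ∸ m / β) (begin
    n ∸ m                                       ≡⟨ cong₂ _∸_ (m≡m%n+[m/n]*n n β) (m≡m%n+[m/n]*n m β) ⟩
    (n % β + n / β * β) ∸ (m % β + m / β * β)  ≡⟨ cong (λ r → (r + _) ∸ (m % β + _)) m≡n ⟨
    (m % β + n / β * β) ∸ (m % β + m / β * β)  ≡⟨ [m+n]∸[m+o]≡n∸o (m % β) _ _ ⟩
    n / β * β ∸ m / β * β                       ≡⟨ *-distribʳ-∸ β (n / β) (m / β) ⟨
    (n / β ∸ m / β) * β                         ∎)
    where open ≡-Reasoning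

  record IsolatedTerm (P : Poly) (e : ℕ) : Set where
    constructor isolated
    field
      coeff≢0 : coeff P e ≢ 0ℚ
      others  : ∀ k → k % β ≡ e % β → k ≢ e → coeff P k ≡ 0ℚ

  isolated⇒≡ : ∀ {P e k} → IsolatedTerm P e → coeff P k ≢ 0ℚ → k % β ≡ e % β → k ≡ e
  isolated⇒≡ {e = e} {k = k} (isolated _ others) Pₖ≢0 k≡e =
    decidable-stable (k ≟ e) λ k≢e → Pₖ≢0 (others k k≡e k≢e)

  ResidueOtherThan : ℕ → ℤ × ℕ → Set
  ResidueOtherThan e t = proj₂ t % β ≢ e % β

  fromTerms-isolated : ∀ pre c e post → int c ≢ 0ℚ
    → All (ResidueOtherThan e) pre → All (ResidueOtherThan e) post
    → IsolatedTerm (fromTerms (pre ++ (c , e) ∷ post)) e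
  fromTerms-isolated pre c e post c≢0 pre-apart post-apart =
    isolated (λ Pₑ≡0 → c≢0 (trans (sym coeffₑ) Pₑ≡0))
             λ k k≡e k≢e → coeff-fromTerms-∉ (pre ++ (c , e) ∷ post)
               (++⁺ (unmatched k≡e pre-apart) (k≢e ∷ unmatched k≡e post-apart))
    where
    unmatched : ∀ {k} → k % β ≡ e % β → ∀ {ts}
      → All (ResidueOtherThan e) ts → All (ExponentOtherThan k) ts
    unmatched k≡e = All.map λ x≢e k≡x → x≢e (trans (cong (_% β) (sym k≡x)) k≡e)
    coeffₑ : coeff (fromTerms (pre ++ (c , e) ∷ post)) e ≡ int c
    coeffₑ = coeff-fromTerms-sole pre post (unmatched refl pre-apart) (unmatched refl post-apart)

  module _ (V Q P : Poly) {e} (β∣ : ∀ i → coeff V i ≢ 0ℚ → β ∣ i) (iso : IsolatedTerm P e)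
           (VQ≈P : (V *P Q) ≈P P) where

    InClass : ℕ → Set
    InClass j = coeff Q j ≢ 0ℚ × j % β ≡ e % β

    InClass? : Decidable InClass
    InClass? j = coeff≢0? Q j ×-dec (j % β ≟ e % β)

    coeff-P : ∀ n → coeff P n ≡ convolution (coeff V) (coeff Q) n
    coeff-P n = trans (sym (VQ≈P n)) (coeff-*P V Q n)

    product-in-class : ∀ {i j} → coeff V i *ℚ coeff Q j ≢ 0ℚ → (i + j) % β ≡ e % β → InClass j
    product-in-class {i} {j} vq≢0 i+j≡e =
        *≢0⇒ʳ≢0 (coeff V i) (coeff Q j) vq≢0
      , trans (sym (%-remove-+ˡ j (β∣ i (*≢0⇒ˡ≢0 _ (coeff Q j) vq≢0)))) i+j≡e

    some-in-class : ∃ InClass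
    some-in-class
      with i , j , i+j≡e , vq≢0 ← convolution-≢0 (coeff V) (coeff Q) e (IsolatedTerm.coeff≢0 iso ∘ trans (coeff-P e))
      = j , product-in-class vq≢0 (cong (_% β) i+j≡e)

    corner-exponent : ∀ {i₀ j₀} → coeff V i₀ ≢ 0ℚ → InClass j₀
      → (∀ {i j} → i + j ≡ i₀ + j₀ → coeff V i ≢ 0ℚ → InClass j → i ≡ i₀)
      → i₀ + j₀ ≡ e
    corner-exponent {i₀} {j₀} Vᵢ₀≢0 (Qⱼ₀≢0 , j₀≡e) only-i₀ = isolated⇒≡ iso Pᵢ₀₊ⱼ₀≢0 i₀+j₀≡e
      where
      i₀+j₀≡e : (i₀ + j₀) % β ≡ e % β
      i₀+j₀≡e = trans (%-remove-+ˡ j₀ (β∣ i₀ Vᵢ₀≢0)) j₀≡e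
      vanish : ∀ {i j} → i + j ≡ i₀ + j₀ → i ≢ i₀ → coeff V i *ℚ coeff Q j ≡ 0ℚ
      vanish i+j≡ i≢i₀ = decidable-stable (_ ≟ℚ 0ℚ) λ vq≢0 →
        i≢i₀ (only-i₀ i+j≡ (*≢0⇒ˡ≢0 _ (coeff Q _) vq≢0)
                           (product-in-class vq≢0 (trans (cong (_% β) i+j≡) i₀+j₀≡e)))
      coeffᵢ₀₊ⱼ₀ : coeff P (i₀ + j₀) ≡ coeff V i₀ *ℚ coeff Q j₀
      coeffᵢ₀₊ⱼ₀ = trans (coeff-P _) (convolution-single (coeff V) (coeff Q) i₀ j₀ vanish)
      Pᵢ₀₊ⱼ₀≢0 : coeff P (i₀ + j₀) ≢ 0ℚ
      Pᵢ₀₊ⱼ₀≢0 P≡0 = *-≢0 Vᵢ₀≢0 Qⱼ₀≢0 (trans (sym coeffᵢ₀₊ⱼ₀) P≡0)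

    no-two-terms : ¬ (∃₂ λ a b → a ≢ b × coeff V a ≢ 0ℚ × coeff V b ≢ 0ℚ)
    no-two-terms (a , b , a≢b , Va≢0 , Vb≢0)
      with j , Cⱼ ← some-in-class
      with i₀ , Vᵢ₀≢0 , i₀≤ ← least (coeff≢0? V) Va≢0
         | i₁ , Vᵢ₁≢0 , ≤i₁ ← greatest (coeff≢0? V) (length V) (coeff≢0⇒<length V) Va≢0
         | j₀ , Cⱼ₀ , j₀≤ ← least InClass? Cⱼ
         | j₁ , Cⱼ₁ , ≤j₁ ← greatest InClass? (length Q) (coeff≢0⇒<length Q ∘ proj₁) Cⱼ
      = <-irrefl (trans lowest≡e highest≡e)
                 (+-mono-<-≤ (least<greatest (Vᵢ₀≢0 , i₀≤) (Vᵢ₁≢0 , ≤i₁) Va≢0 Vb≢0 a≢b) (j₀≤ Cⱼ₁))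
      where
      lowest≡e : i₀ + j₀ ≡ e
      lowest≡e = corner-exponent Vᵢ₀≢0 Cⱼ₀ λ i+j≡ Vᵢ≢0 Cⱼ′ →
        sym (≤-+-≡⇒≡ (i₀≤ Vᵢ≢0) (j₀≤ Cⱼ′) (sym i+j≡))
      highest≡e : e ≡ i₁ + j₁
      highest≡e = sym (corner-exponent Vᵢ₁≢0 Cⱼ₁ λ i+j≡ Vᵢ≢0 Cⱼ′ →
        ≤-+-≡⇒≡ (≤i₁ Vᵢ≢0) (≤j₁ Cⱼ′) i+j≡)

  isolated⇒¬∣P : ∀ V {P e} → (∃₂ λ a b → a ≢ b × coeff V a ≢ 0ℚ × coeff V b ≢ 0ℚ)
    → (∀ i → coeff V i ≢ 0ℚ → β ∣ i) → IsolatedTerm P e → ¬ (V ∣P P)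
  isolated⇒¬∣P V {P} two β∣ iso (Q , VQ≈P) = no-two-terms V Q P β∣ iso VQ≈P two

-- U t and W t are, definitionally, fromTerms (terms-of-shape t …) for their coefficients.
terms-of-shape : ℕ → (c₁ c₂ c₃ c₄ c₅ c₆ c₇ c₈ c₉ c₁₀ : ℤ) → List (ℤ × ℕ)
terms-of-shape t c₁ c₂ c₃ c₄ c₅ c₆ c₇ c₈ c₉ c₁₀ =
  (c₁ , 2 * t ∸ 1) ∷ (c₂ , t + 3) ∷ (c₃ , t + 2) ∷ (c₄ , t + 1) ∷ (c₅ , t) ∷
  (c₆ , t ∸ 1) ∷ (c₇ , t ∸ 2) ∷ (c₈ , t ∸ 3) ∷ (c₉ , t ∸ 4) ∷ (c₁₀ , 0) ∷ []

module _ (β : ℕ) .{{_ : NonZero β}} (6≤β : 6 ≤ β) where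

  Avoids : ℕ → ℕ → ℕ → Set
  Avoids a b x = a % β ≢ x % β × b % β ≢ x % β

  avoids-or-hits : ∀ a b x → Avoids a b x ⊎ (a % β ≡ x % β ⊎ b % β ≡ x % β)
  avoids-or-hits a b x with a % β ≟ x % β | b % β ≟ x % β
  ... | yes a≡x | _       = inj₂ (inj₁ a≡x)
  ... | no a≢x  | yes b≡x = inj₂ (inj₂ b≡x)
  ... | no a≢x  | no b≢x  = inj₁ (a≢x , b≢x)

  offset-residue : ∀ d m .{{_ : NonZero d}} {_ : True (d ≤? 5)} → (d + m) % β ≢ m % β
  offset-residue d m {d≤5} d+m≡m = >⇒∤ (≤-trans (s≤s (toWitness d≤5)) 6≤β)
    (subst (β ∣_) (m+n∸n≡m d m) (≡-mod⇒∣∸ β (sym d+m≡m)))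

  above : ∀ {x e} d .{{_ : NonZero d}} {_ : True (d ≤? 5)} → x ≡ d + e → x % β ≢ e % β
  above {e = e} d {d≤5} refl = offset-residue d e {d≤5}

  below : ∀ {x e} d .{{_ : NonZero d}} {_ : True (d ≤? 5)} → e ≡ d + x → x % β ≢ e % β
  below {x} d {d≤5} refl = offset-residue d x {d≤5} ∘ sym

  -- each of a and b shares its residue with at most one of m, 1 + m, 2 + m
  avoiding : ∀ a b m → Avoids a b m ⊎ Avoids a b (1 + m) ⊎ Avoids a b (2 + m)
  avoiding a b m with avoids-or-hits a b m | avoids-or-hits a b (1 + m) | avoids-or-hits a b (2 + m)
  ... | inj₁ avoids | _ | _ = inj₁ avoids
  ... | _ | inj₁ avoids | _ = inj₂ (inj₁ avoids)
  ... | _ | _ | inj₁ avoids = inj₂ (inj₂ avoids)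
  ... | inj₂ (inj₁ a≡m) | inj₂ (inj₁ a≡1+m) | _ = ⊥-elim (offset-residue 1 m (trans (sym a≡1+m) a≡m))
  ... | inj₂ (inj₂ b≡m) | inj₂ (inj₂ b≡1+m) | _ = ⊥-elim (offset-residue 1 m (trans (sym b≡1+m) b≡m))
  ... | inj₂ (inj₁ a≡m) | _ | inj₂ (inj₁ a≡2+m) = ⊥-elim (offset-residue 2 m (trans (sym a≡2+m) a≡m))
  ... | inj₂ (inj₂ b≡m) | _ | inj₂ (inj₂ b≡2+m) = ⊥-elim (offset-residue 2 m (trans (sym b≡2+m) b≡m))
  ... | _ | inj₂ (inj₁ a≡1+m) | inj₂ (inj₁ a≡2+m) = ⊥-elim (offset-residue 1 (1 + m) (trans (sym a≡2+m) a≡1+m))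
  ... | _ | inj₂ (inj₂ b≡1+m) | inj₂ (inj₂ b≡2+m) = ⊥-elim (offset-residue 1 (1 + m) (trans (sym b≡2+m) b≡1+m))

  shape-isolated : ∀ s c₁ c₂ c₃ c₄ c₅ c₆ c₇ c₈ c₉ c₁₀
    → int c₅ ≢ 0ℚ → int c₆ ≢ 0ℚ → int c₇ ≢ 0ℚ
    → ∃ (IsolatedTerm β (fromTerms (terms-of-shape (4 + s) c₁ c₂ c₃ c₄ c₅ c₆ c₇ c₈ c₉ c₁₀)))
  shape-isolated s c₁ c₂ c₃ c₄ c₅ c₆ c₇ c₈ c₉ c₁₀ c₅≢0 c₆≢0 c₇≢0 =
    isolate (avoiding (2 * t ∸ 1) 0 (t ∸ 2))
    where
    t : ℕ
    t = 4 + s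
    ts : List (ℤ × ℕ)
    ts = terms-of-shape t c₁ c₂ c₃ c₄ c₅ c₆ c₇ c₈ c₉ c₁₀
    isolate : Avoids (2 * t ∸ 1) 0 (t ∸ 2) ⊎ Avoids (2 * t ∸ 1) 0 (t ∸ 1) ⊎ Avoids (2 * t ∸ 1) 0 t
      → ∃ (IsolatedTerm β (fromTerms ts))
    isolate (inj₁ (top≢ , 0≢)) = t ∸ 2 , fromTerms-isolated β (take 6 ts) c₇ (t ∸ 2) (drop 7 ts) c₇≢0
      (top≢ ∷ above 5 (+-comm t 3) ∷ above 4 (+-comm t 2) ∷ above 3 (+-comm t 1) ∷ above 2 refl ∷ above 1 refl ∷ [])
      (below 1 refl ∷ below 2 refl ∷ 0≢ ∷ [])
    isolate (inj₂ (inj₁ (top≢ , 0≢))) = t ∸ 1 , fromTerms-isolated β (take 5 ts) c₆ (t ∸ 1) (drop 6 ts) c₆≢0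
      (top≢ ∷ above 4 (+-comm t 3) ∷ above 3 (+-comm t 2) ∷ above 2 (+-comm t 1) ∷ above 1 refl ∷ [])
      (below 1 refl ∷ below 2 refl ∷ below 3 refl ∷ 0≢ ∷ [])
    isolate (inj₂ (inj₂ (top≢ , 0≢))) = t , fromTerms-isolated β (take 4 ts) c₅ t (drop 5 ts) c₅≢0
      (top≢ ∷ above 3 (+-comm t 3) ∷ above 2 (+-comm t 2) ∷ above 1 (+-comm t 1) ∷ [])
      (below 1 refl ∷ below 2 refl ∷ below 3 refl ∷ below 4 refl ∷ 0≢ ∷ [])

-- t need not be even.
lemma5p3 : (t β : ℕ) → 2 ∣ t → 4 ≤ t → 6 ≤ β → (V : Poly)
    → (∃₂ λ i j → i ≢ j × coeff V i ≢ 0ℚ × coeff V j ≢ 0ℚ)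
    → (∀ i → coeff V i ≢ 0ℚ → β ∣ i)
    → ¬ (V ∣P U t) × ¬ (V ∣P W t)
lemma5p3 _ β@(suc _) _ (s≤s (s≤s (s≤s (s≤s {n = s} z≤n)))) 6≤β V two-terms β∣ =
    isolated⇒¬∣P β V two-terms β∣ (proj₂ U-isolated)
  , isolated⇒¬∣P β V two-terms β∣ (proj₂ W-isolated)
  where
  U-isolated : ∃ (IsolatedTerm β (U (4 + s)))
  U-isolated = shape-isolated β 6≤β s
    (+ 2) (+ 1) -[1+ 0 ] (+ 1) -[1+ 2 ] (+ 3) -[1+ 0 ] (+ 1) -[1+ 0 ] -[1+ 1 ] (λ ()) (λ ()) (λ ())
  W-isolated : ∃ (IsolatedTerm β (W (4 + s)))
  W-isolated = shape-isolated β 6≤β s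
    (+ 2) -[1+ 0 ] (+ 1) -[1+ 0 ] -[1+ 0 ] (+ 1) (+ 1) -[1+ 0 ] (+ 1) -[1+ 1 ] (λ ()) (λ ()) (λ ())
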